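{- Work in $\mathsf{IKP} + \mathsf{\Delta_0\text{ - }BTEE}_M$. Let $K$ be a transitive set such that $K\models \Delta_0\text{ -Separation}$ and $\omega\in K$, and let $j\colon V\to M$ be a $\Delta_0$-elementary embedding whose critical point is $K$. Then for every $a\in K$, $\mathcal{P}(a)\cap K=\mathcal{P}(a)\cap j(K)$, i.e. a set $b\subseteq a$ belongs to $K$ if and only if it belongs to $j(K)$.
   Context: All theories use intuitionistic logic. $\mathsf{IKP}$ consists of Extensionality, Pairing, Union, Infinity, Set Induction, $\Delta_0$-Collection and $\Delta_0$-Separation. The language is $\{\in\}$ extended by a unary function symbol $j$ and a unary predicate symbol $M$. $\mathsf{IKP}+\mathsf{\Delta_0\text{ - }BTEE}_M$ asserts the axioms of $\mathsf{IKP}$, that $M$ is a transitive class, $\forall x\, M(j(x))$, $M\models\mathsf{IKP}$, that $j$ is $\Delta_0$-elementary ($\forall\vec x\,[\phi(\vec x)\leftrightarrow \phi^M(j(\vec x))]$ for every $\Delta_0$ $\in$-formula $\phi$), and that $j$ has a critical point. A critical point of $j$ is a transitive set $K$ with $K\in j(K)$ and $j(x)=x$ for all $x\in K$. -}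

module Defs where

-- Semantic rendering of IKP + Δ0-BTEE_M: an intuitionistic (Agda-internal)
-- first-order structure for the language {∈, j, M} (with equality ≈),
-- a deep embedding of formulas (so that axiom SCHEMES range exactly over
-- first-order formulas of the right class), and the axioms.

open import Level using (Level) renaming (suc to lsuc)
open import Data.Nat using (ℕ; zero; suc)
open import Data.Fin using (Fin; zero; suc)
open import Data.Product using (Σ; _×_; _,_)
open import Data.Sum using (_⊎_)
open import Data.Empty.Polymorphic using (⊥)
open import Data.Unit using (⊤)
open import Function using (_∘_)
open import Function.Bundles using (_⇔_)

data Term (n : ℕ) : Set where
  var : Fin n → Term n
  jt  : Term n → Term n

data Fm (n : ℕ) : Set where
  _∈'_ _≐_     : Term n → Term n → Fm n
  𝕄            : Term n → Fm n
  ⊥'           : Fm n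
  _∧'_ _∨'_ _⇒_ : Fm n → Fm n → Fm n
  ∀' ∃'        : Fm (suc n) → Fm n
  ∀∈ ∃∈        : Term n → Fm (suc n) → Fm n

data IsΔ₀ {n : ℕ} : Fm n → Set where
  mem : ∀ t u → IsΔ₀ (t ∈' u)
  eq  : ∀ t u → IsΔ₀ (t ≐ u)
  mm  : ∀ t → IsΔ₀ (𝕄 t)
  bot : IsΔ₀ ⊥'
  and : ∀ {φ ψ} → IsΔ₀ φ → IsΔ₀ ψ → IsΔ₀ (φ ∧' ψ)
  or  : ∀ {φ ψ} → IsΔ₀ φ → IsΔ₀ ψ → IsΔ₀ (φ ∨' ψ)
  imp : ∀ {φ ψ} → IsΔ₀ φ → IsΔ₀ ψ → IsΔ₀ (φ ⇒ ψ)
  ball : ∀ t {φ} → IsΔ₀ φ → IsΔ₀ (∀∈ t φ)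
  bex  : ∀ t {φ} → IsΔ₀ φ → IsΔ₀ (∃∈ t φ)

data IsPure {n : ℕ} : Fm n → Set where
  mem : ∀ i k → IsPure (var i ∈' var k)
  eq  : ∀ i k → IsPure (var i ≐ var k)
  bot : IsPure ⊥'
  and : ∀ {φ ψ} → IsPure φ → IsPure ψ → IsPure (φ ∧' ψ)
  or  : ∀ {φ ψ} → IsPure φ → IsPure ψ → IsPure (φ ∨' ψ)
  imp : ∀ {φ ψ} → IsPure φ → IsPure ψ → IsPure (φ ⇒ ψ)
  all : ∀ {φ} → IsPure φ → IsPure (∀' φ)
  ex  : ∀ {φ} → IsPure φ → IsPure (∃' φ)
  ball : ∀ i {φ} → IsPure φ → IsPure (∀∈ (var i) φ)
  bex  : ∀ i {φ} → IsPure φ → IsPure (∃∈ (var i) φ)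

PureΔ₀ : ∀ {n} → Fm n → Set
PureΔ₀ φ = IsPure φ × IsΔ₀ φ

AnyFm : ∀ {n} → Fm n → Set
AnyFm _ = ⊤

record Structure (ℓ : Level) : Set (lsuc ℓ) where
  field
    V   : Set ℓ
    _∈_ : V → V → Set ℓ
    _≈_ : V → V → Set ℓ
    j   : V → V
    M   : V → Set ℓ

module Semantics {ℓ : Level} (S : Structure ℓ) where
  open Structure S

  Class : Set (lsuc ℓ)
  Class = V → Set ℓ

  All : Class
  All _ = ⊤'
    where open import Data.Unit.Polymorphic renaming (⊤ to ⊤')

  Env : ℕ → Set ℓ
  Env n = Fin n → V

  ext : ∀ {n} → V → Env n → Env (suc n)
  ext x ρ zero    = x
  ext x ρ (suc i) = ρ i

  EnvIn : Class → ∀ {n} → Env n → Set ℓ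
  EnvIn C ρ = ∀ i → C (ρ i)

  ⟦_⟧t : ∀ {n} → Term n → Env n → V
  ⟦ var i ⟧t ρ = ρ i
  ⟦ jt t ⟧t ρ  = j (⟦ t ⟧t ρ)

  Sat : Class → ∀ {n} → Fm n → Env n → Set ℓ
  Sat C (t ∈' u) ρ = ⟦ t ⟧t ρ ∈ ⟦ u ⟧t ρ
  Sat C (t ≐ u)  ρ = ⟦ t ⟧t ρ ≈ ⟦ u ⟧t ρ
  Sat C (𝕄 t)    ρ = M (⟦ t ⟧t ρ)
  Sat C ⊥'       ρ = ⊥ {ℓ}
  Sat C (φ ∧' ψ) ρ = Sat C φ ρ × Sat C ψ ρ
  Sat C (φ ∨' ψ) ρ = Sat C φ ρ ⊎ Sat C ψ ρ
  Sat C (φ ⇒ ψ)  ρ = Sat C φ ρ → Sat C ψ ρ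
  Sat C (∀' φ)   ρ = ∀ x → C x → Sat C φ (ext x ρ)
  Sat C (∃' φ)   ρ = Σ V λ x → C x × Sat C φ (ext x ρ)
  Sat C (∀∈ t φ) ρ = ∀ x → C x → x ∈ ⟦ t ⟧t ρ → Sat C φ (ext x ρ)
  Sat C (∃∈ t φ) ρ = Σ V λ x → C x × (x ∈ ⟦ t ⟧t ρ × Sat C φ (ext x ρ))

  FmClass : Set₁
  FmClass = ∀ {n} → Fm n → Set

  Extensionality : Class → Set ℓ
  Extensionality C = ∀ a b → C a → C b →
    (∀ x → C x → (x ∈ a ⇔ x ∈ b)) → a ≈ b

  Pairing : Class → Set ℓ
  Pairing C = ∀ a b → C a → C b → Σ V λ c → C c × (a ∈ c × b ∈ c)

  Union : Class → Set ℓ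
  Union C = ∀ a → C a → Σ V λ c → C c ×
    (∀ x → C x → x ∈ a → ∀ y → C y → y ∈ x → y ∈ c)

  Infinity : Class → Set ℓ
  Infinity C = Σ V λ w → C w × ((Σ V λ e → C e × e ∈ w) ×
    (∀ x → C x → x ∈ w → Σ V λ y → C y × (y ∈ w × x ∈ y)))

  SetInduction : Class → FmClass → Set ℓ
  SetInduction C Φ = ∀ {n} (φ : Fm (suc n)) → Φ φ → (ρ : Env n) → EnvIn C ρ →
    (∀ a → C a → (∀ x → C x → x ∈ a → Sat C φ (ext x ρ)) → Sat C φ (ext a ρ)) →
    ∀ a → C a → Sat C φ (ext a ρ)

  Separation : Class → FmClass → Set ℓ
  Separation C Δ = ∀ {n} (φ : Fm (suc n)) → Δ φ → (ρ : Env n) → EnvIn C ρ →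
    ∀ a → C a → Σ V λ b → C b ×
      (∀ x → C x → (x ∈ b ⇔ (x ∈ a × Sat C φ (ext x ρ))))

  -- φ(x,y): y is variable 0, x is variable 1
  Collection : Class → FmClass → Set ℓ
  Collection C Δ = ∀ {n} (φ : Fm (suc (suc n))) → Δ φ → (ρ : Env n) → EnvIn C ρ →
    ∀ a → C a →
    (∀ x → C x → x ∈ a → Σ V λ y → C y × Sat C φ (ext y (ext x ρ))) →
    Σ V λ b → C b ×
      (∀ x → C x → x ∈ a → Σ V λ y → C y × (y ∈ b × Sat C φ (ext y (ext x ρ))))

  record IKP (C : Class) (Δ Φ : FmClass) : Set ℓ where
    field
      extensionality : Extensionality C
      pairing        : Pairing C
      union          : Union C
      infinity       : Infinity C
      setInduction   : SetInduction C Φ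
      separation     : Separation C Δ
      collection     : Collection C Δ

  record EqualityAxioms : Set ℓ where
    field
      ≈-refl  : ∀ x → x ≈ x
      ≈-sym   : ∀ {x y} → x ≈ y → y ≈ x
      ≈-trans : ∀ {x y z} → x ≈ y → y ≈ z → x ≈ z
      ∈-congˡ : ∀ {x y z} → x ≈ y → x ∈ z → y ∈ z
      ∈-congʳ : ∀ {x y z} → y ≈ z → x ∈ y → x ∈ z
      j-cong  : ∀ {x y} → x ≈ y → j x ≈ j y
      M-cong  : ∀ {x y} → x ≈ y → M x → M y

  Transitive : V → Set ℓ
  Transitive K = ∀ y → y ∈ K → ∀ x → x ∈ y → x ∈ K

  CriticalPoint : V → Set ℓ
  CriticalPoint K = Transitive K × (K ∈ j K × (∀ x → x ∈ K → j x ≈ x))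

  Inductive : V → Set ℓ
  Inductive y = (Σ V λ e → e ∈ y × (∀ z → z ∈ e → ⊥ {ℓ})) ×
    (∀ x → x ∈ y → Σ V λ s → s ∈ y × (∀ z → (z ∈ s ⇔ (z ∈ x ⊎ z ≈ x))))

  IsOmega : V → Set ℓ
  IsOmega w = Inductive w × (∀ y → Inductive y → ∀ x → x ∈ w → x ∈ y)

  record Model : Set ℓ where
    field
      equality   : EqualityAxioms
      ikpV       : IKP All IsΔ₀ AnyFm
      M-transitive : ∀ y → M y → ∀ x → x ∈ y → M x
      j-into-M   : ∀ x → M (j x)
      ikpM       : IKP M PureΔ₀ IsPure
      elementary : ∀ {n} (φ : Fm n) → PureΔ₀ φ → (ρ : Env n) →
                     Sat All φ ρ ⇔ Sat M φ (j ∘ ρ)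
      criticalPoint : Σ V CriticalPoint

{-# OPTIONS --safe #-}
-- Every b ⊆ a with a ∈ K is fixed by j: an element x of j b lies in
-- j b ⊆ j a = a ⊆ K, so j x = x, and x ∈ j b ↔ j x ∈ j b ↔ x ∈ b by
-- elementarity; extensionality gives j b = b. Hence b ∈ K ↔ j b ∈ j K ↔ b ∈ j K.
module Submission where

open import Defs
open import Data.Fin using (zero; suc)
open import Data.Product using (Σ; _×_; _,_; proj₁; proj₂)
open import Function using (_∘_)
open import Function.Bundles using (_⇔_; mk⇔; module Equivalence)
import Function.Properties.Equivalence as ⇔

module ElementaryEmbedding {ℓ} {S : Structure ℓ} (model : Semantics.Model S) where
  open Structure S
  open Semantics S
  open Model model
  open EqualityAxioms equality
  open Equivalence

  _⊆_ : V → V → Set ℓ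
  b ⊆ a = ∀ z → z ∈ b → z ∈ a

  env₂ : V → V → Env 2
  env₂ x y = ext x (ext y λ ())

  ∈-resp-≈ˡ : ∀ {x y z} → x ≈ y → x ∈ z ⇔ y ∈ z
  ∈-resp-≈ˡ x≈y = mk⇔ (∈-congˡ x≈y) (∈-congˡ (≈-sym x≈y))

  ∈⇔j∈j : ∀ x y → x ∈ y ⇔ j x ∈ j y
  ∈⇔j∈j x y = elementary (var zero ∈' var (suc zero)) (mem zero (suc zero) , mem _ _) (env₂ x y)

  ⊆-formula : Fm 2
  ⊆-formula = ∀∈ (var zero) (var zero ∈' var (suc (suc zero)))

  ⊆⇔⊆ᴹ : ∀ a b → Sat All ⊆-formula (env₂ b a) ⇔ Sat M ⊆-formula (j ∘ env₂ b a)
  ⊆⇔⊆ᴹ a b = elementary ⊆-formula (ball zero (mem zero (suc (suc zero))) , ball _ (mem _ _)) (env₂ b a)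

  -- Elementarity only yields the inclusion relativised to M; transitivity of M removes it.
  j-mono-⊆ : ∀ {a b} → b ⊆ a → j b ⊆ j a
  j-mono-⊆ {a} {b} b⊆a z z∈jb = to (⊆⇔⊆ᴹ a b) (λ x _ → b⊆a x) z z∈M z∈jb
    where
      z∈M : M z
      z∈M = M-transitive (j b) (j-into-M b) z z∈jb

  j-fixes-subsets : ∀ {a b} → j a ≈ a → (∀ x → x ∈ a → j x ≈ x) → b ⊆ a → j b ≈ b
  j-fixes-subsets {a} {b} ja≈a fixes b⊆a =
    IKP.extensionality ikpV (j b) b _ _ λ x _ → mk⇔ (from-jb x) (to-jb x)
    where
      to-jb : ∀ x → x ∈ b → x ∈ j b
      to-jb x x∈b = ∈-congˡ (fixes x (b⊆a x x∈b)) (to (∈⇔j∈j x b) x∈b)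

      from-jb : ∀ x → x ∈ j b → x ∈ b
      from-jb x x∈jb = from (∈⇔j∈j x b) (∈-congˡ (≈-sym (fixes x x∈a)) x∈jb)
        where
          x∈a : x ∈ a
          x∈a = ∈-congʳ ja≈a (j-mono-⊆ b⊆a x x∈jb)

  module _ {K : V} (critical : CriticalPoint K) where
    K-transitive : Transitive K
    K-transitive = proj₁ critical

    K-fixed : ∀ x → x ∈ K → j x ≈ x
    K-fixed = proj₂ (proj₂ critical)

    subset-of-element-fixed : ∀ {a b} → a ∈ K → b ⊆ a → j b ≈ b
    subset-of-element-fixed {a} a∈K =
      j-fixes-subsets (K-fixed a a∈K) λ x x∈a → K-fixed x (K-transitive a a∈K x x∈a)

    subset-of-element-∈⇔∈j : ∀ {a b} → a ∈ K → b ⊆ a → b ∈ K ⇔ b ∈ j K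
    subset-of-element-∈⇔∈j a∈K b⊆a =
      ⇔.trans (∈⇔j∈j _ K) (∈-resp-≈ˡ (subset-of-element-fixed a∈K b⊆a))

mainTheorem2 : ∀ {ℓ} (S : Structure ℓ) →
    let open Semantics S in
    Model → (K : Structure.V S) → Transitive K → Separation (λ x → Structure._∈_ S x K) PureΔ₀ →
    (Σ (Structure.V S) λ w → IsOmega w × Structure._∈_ S w K) → CriticalPoint K →
    ∀ a → Structure._∈_ S a K → ∀ b →
    (∀ z → Structure._∈_ S z b → Structure._∈_ S z a) →
    (Structure._∈_ S b K ⇔ Structure._∈_ S b (Structure.j S K))
mainTheorem2 S model K _ _ _ critical a a∈K b b⊆a =
  subset-of-element-∈⇔∈j critical a∈K b⊆a
  where open ElementaryEmbedding model
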